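{- Let $n$ be a positive integer that is coprime to $6$, divisible by $5$, and not divisible by $25$. Then it is impossible to place $n^2$ queens on $\mathbb{Z}_n^3$ with no two in conflict.
   Context: A queen on $\mathbb{Z}_n^d$ (coordinates modulo $n$) can move any number of times by a vector $\mathbf{x}\in\{ -1,0,1\}^d\setminus\{\mathbf{0}\}$. Queens occupy distinct fields, and two queens on fields $\mathbf{a}\ne\mathbf{b}$ are in conflict if $\mathbf{b}-\mathbf{a}=k\mathbf{x}$ in $\mathbb{Z}_n^d$ for some integer $k$ and some nonzero $\mathbf{x}\in\{ -1,0,1\}^d$. Here $d=3$. -}

module Defs where

open import Data.Nat using (ℕ)
open import Data.Fin using (Fin; toℕ)
open import Data.Integer using (ℤ; +_; -_; _-_; _*_; 0ℤ; 1ℤ)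
open import Data.Integer.Divisibility using (_∣_)
open import Data.Product using (Σ; ∃; _×_)
open import Relation.Binary.PropositionalEquality using (_≡_; _≢_)
open import Relation.Nullary using (¬_)
open import Function.Definitions using (Injective)

d : ℕ
d = 3

Field : ℕ → Set
Field n = Fin d → Fin n

data Step : Set where
  minus zero plus : Step

stepℤ : Step → ℤ
stepℤ minus = - 1ℤ
stepℤ zero  = 0ℤ
stepℤ plus  = 1ℤ

Dir : Set
Dir = Fin d → Step

NonZeroDir : Dir → Set
NonZeroDir x = ¬ (∀ i → x i ≡ zero)

_≡_[mod_] : ℤ → ℤ → ℕ → Set
a ≡ b [mod n ] = (+ n) ∣ (a - b)

Conflict : (n : ℕ) → Field n → Field n → Set
Conflict n a b =
  Σ ℤ λ k → Σ Dir λ x → NonZeroDir x ×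
    (∀ i → ((+ toℕ (b i)) - (+ toℕ (a i))) ≡ k * stepℤ (x i) [mod n ])

NonConflictingPlacement : (n m : ℕ) → Set
NonConflictingPlacement n m =
  Σ (Fin m → Field n) λ q →
    Injective _≡_ _≡_ q ×
    (∀ i j → i ≢ j → ¬ Conflict n (q i) (q j))

-- The 13 move vectors up to sign give 13 slopes, each partitioning ℤₙ³ into n² parallel
-- lines; two queens on a common line are in conflict, so n² non-conflicting queens meet
-- every line exactly once. Weight each line by a function of its slope and of its
-- coordinates modulo 5 only, chosen so that the 13 lines through any point of ℤ₅³ have total
-- weight ≡ 0 (mod 5). Adding up, queen by queen, the weights of the lines through the queens
-- gives a multiple of 5; adding them up line by line gives (n/5)² · W, where W ≡ 1 (mod 5)
-- is the total weight of the lines of ℤ₅³. Hence 5 ∣ n/5.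

module Submission where

open import Defs
open import Data.Nat using (ℕ; _^_; _>_)
open import Data.Nat.Divisibility using (_∣_)
open import Data.Nat.Coprimality using (Coprime)
open import Relation.Nullary using (¬_)

open import Data.Nat
  using (zero; suc; _+_; _*_; _∸_; _%_; _/_; _≤_; NonZero; ≢-nonZero⁻¹; >-nonZero⁻¹)
open import Data.Nat.Properties
  using (+-*-semiring; +-assoc; *-identityʳ; +-∸-comm; m∸n+n≡m; ≤-reflexive; <⇒≱)
open import Data.Nat.DivMod
  using (_mod_; m≡m%n+[m/n]*n; m%n%n≡m%n; m<n⇒m%n≡m; [m+kn]%n≡m%n; %-distribˡ-+; %-distribˡ-*;
         %-remove-+ˡ; m∣n⇒o%n%m≡o%m)
open import Data.Nat.Divisibility using (divides; _∣?_; _∣0; ∣m∣n⇒∣m+n; *-monoˡ-∣; m∣m*n; n∣m*n)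
open import Data.Nat.Primality using (Prime; prime?; euclidsLemma)
open import Data.Fin as Fin using (Fin; toℕ; combine; remQuot; _↑ˡ_; _↑ʳ_; punchOut; _≟_)
open import Data.Fin.Patterns using (0F; 1F; 2F; 3F; 4F)
open import Data.Fin.Properties
  using (any?; all?; injective⇒≤; punchOut-injective; toℕ-injective; toℕ-fromℕ<; toℕ<n; toℕ-combine;
         remQuot-combine)
open import Data.Fin.Permutation using (Permutation)
open import Data.Vec.Functional using (Vector; []; _∷_)
open import Data.Integer as ℤ using (ℤ; +_; _-_)
import Data.Integer.Properties as ℤ
open import Data.Integer.Divisibility.Signed using (∣⇒∣ᵤ; ∣m∣n⇒∣m-n; ∣n⇒∣m*n)
  renaming (_∣_ to _∣ℤ_; divides to dividesℤ)
open import Data.Integer.Tactic.RingSolver using (solve-∀)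
open import Data.Product using (∃; _×_; _,_; proj₁; proj₂; uncurry; map)
open import Data.Product.Properties using (,-injectiveˡ; ,-injectiveʳ)
open import Data.Sum using (inj₁; inj₂)
open import Function using (_∘_)
open import Function.Bundles using (mk↔ₛ′)
open import Function.Definitions using (Injective)
open import Relation.Nullary using (yes; no; contradiction)
open import Relation.Nullary.Decidable using (from-yes; from-no)
open import Relation.Binary.PropositionalEquality
open ≡-Reasoning

open import Algebra.Properties.Semiring.Sum +-*-semiring
  using (sum-syntax; sum-cong-≗; sum-permute; ∑-comm; *-distribˡ-sum)

injective⇒surjective : ∀ {m n} {f : Fin m → Fin n} → n ≤ m → Injective _≡_ _≡_ f →
                       ∀ j → ∃ λ i → f i ≡ j
injective⇒surjective {n = zero}  _ _ ()
injective⇒surjective {n = suc n} {f} n<m f-inj j with any? (λ i → f i ≟ j)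
... | yes found = found
... | no  missed = contradiction (injective⇒≤ punchOut∘f-injective) (<⇒≱ n<m)
  where
  f≢j : ∀ i → j ≢ f i
  f≢j i j≡fi = missed (i , sym j≡fi)

  punchOut∘f-injective : Injective _≡_ _≡_ (λ i → punchOut (f≢j i))
  punchOut∘f-injective eq = f-inj (punchOut-injective (f≢j _) (f≢j _) eq)

∑-reindex-injective : ∀ {m n} (f : Fin m → Fin n) → n ≤ m → Injective _≡_ _≡_ f →
                      (g : Fin n → ℕ) → ∑[ i < m ] g (f i) ≡ ∑[ j < n ] g j
∑-reindex-injective f n≤m f-inj g = sym (sum-permute g π)
  where
  surj : ∀ j → ∃ λ i → f i ≡ j
  surj = injective⇒surjective n≤m f-inj

  π : Permutation _ _
  π = mk↔ₛ′ f (proj₁ ∘ surj) (proj₂ ∘ surj) (λ i → f-inj (proj₂ (surj (f i))))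

∑-++ : ∀ m k (f : Fin (m + k) → ℕ) →
       ∑[ u < m + k ] f u ≡ ∑[ i < m ] f (i ↑ˡ k) + ∑[ j < k ] f (m ↑ʳ j)
∑-++ zero    k f = refl
∑-++ (suc m) k f = begin
  f 0F + ∑[ u < m + k ] f (Fin.suc u)
    ≡⟨ cong (_+_ (f 0F)) (∑-++ m k (f ∘ Fin.suc)) ⟩
  f 0F + (∑[ i < m ] f (Fin.suc i ↑ˡ k) + ∑[ j < k ] f (suc m ↑ʳ j))
    ≡⟨ sym (+-assoc (f 0F) _ _) ⟩
  ∑[ i < suc m ] f (i ↑ˡ k) + ∑[ j < k ] f (suc m ↑ʳ j)
    ∎

∑-combine : ∀ m k (f : Fin (m * k) → ℕ) →
            ∑[ u < m * k ] f u ≡ ∑[ i < m ] ∑[ j < k ] f (combine i j)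
∑-combine zero    k f = refl
∑-combine (suc m) k f =
  trans (∑-++ k (m * k) f)
        (cong (_+_ (∑[ j < k ] f (j ↑ˡ (m * k)))) (∑-combine m k (f ∘ (k ↑ʳ_))))

∑-const : ∀ m c → ∑[ i < m ] c ≡ m * c
∑-const zero    c = refl
∑-const (suc m) c = cong (_+_ c) (∑-const m c)

∑-periodic : ∀ m p .{{_ : NonZero p}} (φ : Fin p → ℕ) →
             ∑[ u < m * p ] φ (toℕ u mod p) ≡ m * ∑[ j < p ] φ j
∑-periodic m p φ = begin
  ∑[ u < m * p ] φ (toℕ u mod p)
    ≡⟨ ∑-combine m p _ ⟩
  ∑[ i < m ] ∑[ j < p ] φ (toℕ (combine i j) mod p)
    ≡⟨ sum-cong-≗ {m} (λ i → sum-cong-≗ {p} (cong φ ∘ combine-mod i)) ⟩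
  ∑[ i < m ] ∑[ j < p ] φ j
    ≡⟨ ∑-const m _ ⟩
  m * ∑[ j < p ] φ j
    ∎
  where
  combine-mod : ∀ (i : Fin m) j → toℕ (combine i j) mod p ≡ j
  combine-mod i j = toℕ-injective (begin
    toℕ (toℕ (combine i j) mod p)  ≡⟨ toℕ-fromℕ< _ ⟩
    toℕ (combine i j) % p          ≡⟨ cong (_% p) (toℕ-combine i j) ⟩
    (p * toℕ i + toℕ j) % p        ≡⟨ %-remove-+ˡ (toℕ j) (m∣m*n (toℕ i)) ⟩
    toℕ j % p                      ≡⟨ m<n⇒m%n≡m (toℕ<n j) ⟩
    toℕ j                          ∎)

∑-injective-pairs : ∀ {N m k} (f : Fin N → Fin m × Fin k) → m * k ≤ N → Injective _≡_ _≡_ f →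
                    (g : Fin m → Fin k → ℕ) →
                    ∑[ t < N ] uncurry g (f t) ≡ ∑[ i < m ] ∑[ j < k ] g i j
∑-injective-pairs {N} {m} {k} f mk≤N f-inj g = begin
  ∑[ t < N ] uncurry g (f t)
    ≡⟨ sum-cong-≗ {N} (cong (uncurry g) ∘ sym ∘ remQuot-index) ⟩
  ∑[ t < N ] uncurry g (remQuot k (index (f t)))
    ≡⟨ ∑-reindex-injective (index ∘ f) mk≤N index∘f-injective _ ⟩
  ∑[ u < m * k ] uncurry g (remQuot k u)
    ≡⟨ ∑-combine m k _ ⟩
  ∑[ i < m ] ∑[ j < k ] uncurry g (remQuot k (combine i j))
    ≡⟨ sum-cong-≗ {m} (λ i → sum-cong-≗ {k} (cong (uncurry g) ∘ remQuot-combine i)) ⟩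
  ∑[ i < m ] ∑[ j < k ] g i j
    ∎
  where
  index : Fin m × Fin k → Fin (m * k)
  index = uncurry combine

  remQuot-index : ∀ t → remQuot k (index (f t)) ≡ f t
  remQuot-index t = remQuot-combine (proj₁ (f t)) (proj₂ (f t))

  index∘f-injective : Injective _≡_ _≡_ (index ∘ f)
  index∘f-injective {s} {t} eq = f-inj (begin
    f s                      ≡⟨ sym (remQuot-index s) ⟩
    remQuot k (index (f s))  ≡⟨ cong (remQuot k) eq ⟩
    remQuot k (index (f t))  ≡⟨ remQuot-index t ⟩
    f t                      ∎)

∑-divisible : ∀ {N} d (f : Fin N → ℕ) → (∀ t → d ∣ f t) → d ∣ ∑[ t < N ] f t
∑-divisible {zero}  d f d∣f = d ∣0
∑-divisible {suc N} d f d∣f = ∣m∣n⇒∣m+n (d∣f 0F) (∑-divisible d (f ∘ Fin.suc) (d∣f ∘ Fin.suc))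

pos-+-* : ∀ a b c → + (a + b * c) ≡ + a ℤ.+ + b ℤ.* + c
pos-+-* a b c = trans (ℤ.pos-+ a (b * c)) (cong (λ r → + a ℤ.+ r) (ℤ.pos-* b c))

%-≡⇒∣ : ∀ n .{{_ : NonZero n}} x y → x % n ≡ y % n → + n ∣ℤ + x - + y
%-≡⇒∣ n x y eq = dividesℤ (+ (x / n) - + (y / n)) (begin
  + x - + y
    ≡⟨ cong₂ _-_ (split x) (split y) ⟩
  (+ (x % n) ℤ.+ + (x / n) ℤ.* + n) - (+ (y % n) ℤ.+ + (y / n) ℤ.* + n)
    ≡⟨ cong (λ r → (+ (x % n) ℤ.+ + (x / n) ℤ.* + n) - (+ r ℤ.+ + (y / n) ℤ.* + n)) (sym eq) ⟩
  (+ (x % n) ℤ.+ + (x / n) ℤ.* + n) - (+ (x % n) ℤ.+ + (y / n) ℤ.* + n)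
    ≡⟨ cancel (+ (x % n)) (+ (x / n)) (+ (y / n)) (+ n) ⟩
  (+ (x / n) - + (y / n)) ℤ.* + n
    ∎)
  where
  split : ∀ z → + z ≡ + (z % n) ℤ.+ + (z / n) ℤ.* + n
  split z = trans (cong +_ (m≡m%n+[m/n]*n z n)) (pos-+-* (z % n) (z / n) n)

  cancel : ∀ r a b c → (r ℤ.+ a ℤ.* c) - (r ℤ.+ b ℤ.* c) ≡ (a - b) ℤ.* c
  cancel = solve-∀

%-affine : ∀ a b {c c′ k} .{{_ : NonZero k}} → c % k ≡ c′ % k →
           (a + c * b) % k ≡ (a % k + c′ * (b % k)) % k
%-affine a b {c} {c′} {k} c≡c′ = begin
  (a + c * b) % k
    ≡⟨ %-distribˡ-+ a (c * b) k ⟩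
  (a % k + c * b % k) % k
    ≡⟨ cong (λ r → (a % k + r) % k) (%-distribˡ-* c b k) ⟩
  (a % k + (c % k) * (b % k) % k) % k
    ≡⟨ cong₂ (λ u v → (a % k + u * v % k) % k) c≡c′ (sym (m%n%n≡m%n b k)) ⟩
  (a % k + (c′ % k) * (b % k % k) % k) % k
    ≡⟨ cong₂ (λ u v → (u + v) % k) (sym (m%n%n≡m%n a k)) (sym (%-distribˡ-* c′ (b % k) k)) ⟩
  (a % k % k + c′ * (b % k) % k) % k
    ≡⟨ sym (%-distribˡ-+ (a % k) (c′ * (b % k)) k) ⟩
  (a % k + c′ * (b % k)) % k
    ∎

data Slope : Set where
  slope : Fin d → Step → Step → Slope

other₁ other₂ : Fin d → Fin d
other₁ 0F = 1F
other₁ 1F = 0F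
other₁ 2F = 0F
other₂ 0F = 2F
other₂ 1F = 2F
other₂ 2F = 1F

direction : Slope → Dir
direction (slope 0F s t) 0F = plus
direction (slope 0F s t) 1F = s
direction (slope 0F s t) 2F = t
direction (slope 1F s t) 0F = s
direction (slope 1F s t) 1F = plus
direction (slope 1F s t) 2F = t
direction (slope 2F s t) 0F = s
direction (slope 2F s t) 1F = t
direction (slope 2F s t) 2F = plus

direction-nonZero : ∀ σ → NonZeroDir (direction σ)
direction-nonZero (slope 0F s t) all-zero with () ← all-zero 0F
direction-nonZero (slope 1F s t) all-zero with () ← all-zero 1F
direction-nonZero (slope 2F s t) all-zero with () ← all-zero 2F

module _ (n : ℕ) .{{_ : NonZero n}} where

  negStep : Step → ℕ
  negStep minus = 1
  negStep zero  = 0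
  negStep plus  = n ∸ 1

  negStep-inverse : ∀ s → + n ∣ℤ + negStep s ℤ.+ stepℤ s
  negStep-inverse minus = dividesℤ (+ 0) refl
  negStep-inverse zero  = dividesℤ (+ 0) refl
  negStep-inverse plus  = dividesℤ (+ 1) (begin
    + (n ∸ 1) ℤ.+ ℤ.1ℤ  ≡⟨ sym (ℤ.pos-+ (n ∸ 1) 1) ⟩
    + (n ∸ 1 + 1)      ≡⟨ cong +_ (m∸n+n≡m (>-nonZero⁻¹ n)) ⟩
    + n                ≡⟨ sym (ℤ.*-identityˡ (+ n)) ⟩
    + 1 ℤ.* + n        ∎)

  intercept : Step → Fin n → Fin n → Fin n
  intercept s x y = (toℕ x + negStep s * toℕ y) mod n

  -- A line of slope (slope i s t) is represented by the other two coordinates of its point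
  -- with coordinate i equal to 0.
  line : Slope → Field n → Fin n × Fin n
  line (slope i s t) p = intercept s (p (other₁ i)) (p i) , intercept t (p (other₂ i)) (p i)

  intercept-≡⇒ : ∀ s {x y x′ y′} → intercept s x y ≡ intercept s x′ y′ →
                 (+ toℕ x′ - + toℕ x) ≡ (+ toℕ y′ - + toℕ y) ℤ.* stepℤ s [mod n ]
  intercept-≡⇒ s {x} {y} {x′} {y′} eq = ∣⇒∣ᵤ {+ n}
    (subst (+ n ∣ℤ_) (sym (rearrange X X′ Y Y′ c (stepℤ s)))
      (∣m∣n⇒∣m-n same-residue (∣n⇒∣m*n (Y′ - Y) (negStep-inverse s))))
    where
    X X′ Y Y′ c : ℤ
    X  = + toℕ x
    X′ = + toℕ x′
    Y  = + toℕ y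
    Y′ = + toℕ y′
    c  = + negStep s

    residues-≡ : (toℕ x′ + negStep s * toℕ y′) % n ≡ (toℕ x + negStep s * toℕ y) % n
    residues-≡ = trans (sym (toℕ-fromℕ< _)) (trans (cong toℕ (sym eq)) (toℕ-fromℕ< _))

    same-residue : + n ∣ℤ (X′ ℤ.+ c ℤ.* Y′) - (X ℤ.+ c ℤ.* Y)
    same-residue = subst (+ n ∣ℤ_)
      (cong₂ _-_ (pos-+-* (toℕ x′) (negStep s) (toℕ y′)) (pos-+-* (toℕ x) (negStep s) (toℕ y)))
      (%-≡⇒∣ n _ _ residues-≡)

    rearrange : ∀ X X′ Y Y′ c s → (X′ - X) - (Y′ - Y) ℤ.* s ≡
                ((X′ ℤ.+ c ℤ.* Y′) - (X ℤ.+ c ℤ.* Y)) - (Y′ - Y) ℤ.* (c ℤ.+ s)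
    rearrange = solve-∀

  pivot-move : ∀ k → k ≡ k ℤ.* stepℤ plus [mod n ]
  pivot-move k = ∣⇒∣ᵤ {+ n} (dividesℤ (+ 0) (trans (cong (k -_) (ℤ.*-identityʳ k)) (ℤ.+-inverseʳ k)))

  sameLine⇒moves : ∀ i s t {a b : Field n} → line (slope i s t) a ≡ line (slope i s t) b → ∀ j →
                   (+ toℕ (b j) - + toℕ (a j))
                     ≡ (+ toℕ (b i) - + toℕ (a i)) ℤ.* stepℤ (direction (slope i s t) j) [mod n ]
  sameLine⇒moves 0F s t {a} {b} eq 0F = pivot-move (+ toℕ (b 0F) - + toℕ (a 0F))
  sameLine⇒moves 0F s t         eq 1F = intercept-≡⇒ s (,-injectiveˡ eq)
  sameLine⇒moves 0F s t         eq 2F = intercept-≡⇒ t (,-injectiveʳ eq)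
  sameLine⇒moves 1F s t         eq 0F = intercept-≡⇒ s (,-injectiveˡ eq)
  sameLine⇒moves 1F s t {a} {b} eq 1F = pivot-move (+ toℕ (b 1F) - + toℕ (a 1F))
  sameLine⇒moves 1F s t         eq 2F = intercept-≡⇒ t (,-injectiveʳ eq)
  sameLine⇒moves 2F s t         eq 0F = intercept-≡⇒ s (,-injectiveˡ eq)
  sameLine⇒moves 2F s t         eq 1F = intercept-≡⇒ t (,-injectiveʳ eq)
  sameLine⇒moves 2F s t {a} {b} eq 2F = pivot-move (+ toℕ (b 2F) - + toℕ (a 2F))

  sameLine⇒Conflict : ∀ σ {a b} → line σ a ≡ line σ b → Conflict n a b
  sameLine⇒Conflict σ@(slope i s t) {a} {b} eq =
    + toℕ (b i) - + toℕ (a i) , direction σ , direction-nonZero σ , sameLine⇒moves i s t {a} {b} eq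

line-cong : ∀ {n} .{{_ : NonZero n}} σ {p p′ : Field n} → (∀ j → p j ≡ p′ j) →
            line n σ p ≡ line n σ p′
line-cong {n} (slope i s t) p≗p′ = cong₂ _,_
  (cong₂ (intercept n s) (p≗p′ (other₁ i)) (p≗p′ i))
  (cong₂ (intercept n t) (p≗p′ (other₂ i)) (p≗p′ i))

placement-line-injective : ∀ {n N} .{{_ : NonZero n}} → ((q , _) : NonConflictingPlacement n N) →
                           ∀ σ → Injective _≡_ _≡_ (line n σ ∘ q)
placement-line-injective {n} (q , _ , non-conflicting) σ {s} {t} eq with s ≟ t
... | yes s≡t = s≡t
... | no  s≢t = contradiction (sameLine⇒Conflict n σ eq) (non-conflicting s t s≢t)

reduce : ∀ {n} k .{{_ : NonZero k}} → Fin n → Fin k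
reduce k x = toℕ x mod k

reduce-id : ∀ {k} .{{_ : NonZero k}} (x : Fin k) → reduce k x ≡ x
reduce-id x = toℕ-injective (trans (toℕ-fromℕ< _) (m<n⇒m%n≡m (toℕ<n x)))

negStep-mod : ∀ {n k} .{{_ : NonZero n}} .{{_ : NonZero k}} → k ∣ n → ∀ s →
              negStep n s % k ≡ negStep k s % k
negStep-mod _ minus = refl
negStep-mod _ zero  = refl
negStep-mod {k = k} (divides zero    refl) plus = contradiction refl (≢-nonZero⁻¹ (zero * k))
negStep-mod {k = k} (divides (suc q) refl) plus = begin
  (k + q * k ∸ 1) % k  ≡⟨ cong (_% k) (+-∸-comm (q * k) (>-nonZero⁻¹ k)) ⟩
  (k ∸ 1 + q * k) % k  ≡⟨ [m+kn]%n≡m%n (k ∸ 1) q k ⟩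
  (k ∸ 1) % k          ∎

module _ {n k} .{{_ : NonZero n}} .{{_ : NonZero k}} (k∣n : k ∣ n) where

  intercept-reduce : ∀ s x y →
                     reduce k (intercept n s x y) ≡ intercept k s (reduce k x) (reduce k y)
  intercept-reduce s x y = toℕ-injective (begin
    toℕ (reduce k (intercept n s x y))
      ≡⟨ toℕ-fromℕ< _ ⟩
    toℕ (intercept n s x y) % k
      ≡⟨ cong (_% k) (toℕ-fromℕ< _) ⟩
    (toℕ x + negStep n s * toℕ y) % n % k
      ≡⟨ m∣n⇒o%n%m≡o%m k n _ k∣n ⟩
    (toℕ x + negStep n s * toℕ y) % k
      ≡⟨ %-affine (toℕ x) (toℕ y) (negStep-mod k∣n s) ⟩
    (toℕ x % k + negStep k s * (toℕ y % k)) % k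
      ≡⟨ sym (cong₂ (λ u v → (u + negStep k s * v) % k) (toℕ-fromℕ< _) (toℕ-fromℕ< _)) ⟩
    (toℕ (reduce k x) + negStep k s * toℕ (reduce k y)) % k
      ≡⟨ sym (toℕ-fromℕ< _) ⟩
    toℕ (intercept k s (reduce k x) (reduce k y))
      ∎)

  line-reduce : ∀ σ p → line k σ (reduce k ∘ p) ≡ map (reduce k) (reduce k) (line n σ p)
  line-reduce (slope i s t) p = sym (cong₂ _,_
    (intercept-reduce s (p (other₁ i)) (p i))
    (intercept-reduce t (p (other₂ i)) (p i)))

-- A solution over 𝔽₅ of the linear system "the lines through each point of ℤ₅³ have total
-- weight 0" with nonzero total weight; both properties are checked by evaluation below.
weight : Slope → Fin 5 → Fin 5 → ℕ
weight (slope 0F minus minus) 1F 0F = 1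
weight (slope 0F minus minus) 1F 2F = 3
weight (slope 0F minus minus) 1F 3F = 1
weight (slope 0F minus minus) 1F 4F = 1
weight (slope 0F minus minus) 2F 0F = 2
weight (slope 0F minus minus) 2F 1F = 2
weight (slope 0F minus minus) 2F 2F = 2
weight (slope 0F minus minus) 3F 2F = 4
weight (slope 0F minus minus) 3F 3F = 2
weight (slope 0F minus minus) 4F 1F = 2
weight (slope 0F minus minus) 4F 3F = 1
weight (slope 0F minus minus) 4F 4F = 3
weight (slope 0F minus zero) 1F 0F = 2
weight (slope 0F minus zero) 1F 1F = 4
weight (slope 0F minus zero) 1F 3F = 2
weight (slope 0F minus zero) 2F 0F = 2
weight (slope 0F minus zero) 2F 2F = 3
weight (slope 0F minus zero) 2F 3F = 3
weight (slope 0F minus zero) 3F 1F = 2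
weight (slope 0F minus zero) 3F 3F = 1
weight (slope 0F minus zero) 4F 0F = 3
weight (slope 0F minus zero) 4F 1F = 4
weight (slope 0F minus zero) 4F 2F = 2
weight (slope 0F minus zero) 4F 3F = 4
weight (slope 0F minus plus) 1F 0F = 4
weight (slope 0F minus plus) 1F 1F = 2
weight (slope 0F minus plus) 2F 1F = 3
weight (slope 0F minus plus) 2F 2F = 3
weight (slope 0F minus plus) 3F 0F = 4
weight (slope 0F minus plus) 3F 1F = 3
weight (slope 0F minus plus) 3F 2F = 4
weight (slope 0F minus plus) 4F 0F = 1
weight (slope 0F minus plus) 4F 1F = 2
weight (slope 0F minus plus) 4F 2F = 3
weight (slope 0F zero minus) 0F 0F = 4
weight (slope 0F zero minus) 0F 2F = 3
weight (slope 0F zero minus) 0F 3F = 1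
weight (slope 0F zero minus) 0F 4F = 4
weight (slope 0F zero minus) 1F 0F = 4
weight (slope 0F zero minus) 1F 1F = 1
weight (slope 0F zero minus) 1F 2F = 3
weight (slope 0F zero minus) 1F 4F = 2
weight (slope 0F zero zero) 0F 0F = 3
weight (slope 0F zero zero) 0F 1F = 4
weight (slope 0F zero zero) 0F 2F = 1
weight (slope 0F zero zero) 0F 3F = 3
weight (slope 0F zero zero) 1F 0F = 3
weight (slope 0F zero zero) 1F 1F = 1
weight (slope 0F zero zero) 1F 2F = 4
weight (slope 0F zero zero) 1F 3F = 2
weight (slope 0F zero plus) 0F 0F = 2
weight (slope 0F plus minus) 0F 0F = 4
weight (slope 0F plus zero) 0F 0F = 2
weight (slope 0F plus plus) 0F 0F = 4
weight (slope 1F zero minus) 0F 0F = 2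
weight (slope 1F zero zero) 0F 0F = 1
weight (slope 1F zero plus) 0F 0F = 2
weight (slope 2F zero zero) 0F 0F = 1
weight _ _ _ = 0

slopes : Vector Slope 13
slopes = slope 0F minus minus ∷ slope 0F minus zero ∷ slope 0F minus plus ∷
         slope 0F zero  minus ∷ slope 0F zero  zero ∷ slope 0F zero  plus ∷
         slope 0F plus  minus ∷ slope 0F plus  zero ∷ slope 0F plus  plus ∷
         slope 1F zero  minus ∷ slope 1F zero  zero ∷ slope 1F zero  plus ∷
         slope 2F zero  zero  ∷ []

lineWeight : ∀ {n} → Slope → Fin n → Fin n → ℕ
lineWeight σ a b = weight σ (reduce 5 a) (reduce 5 b)

pointWeight : ∀ {n} .{{_ : NonZero n}} → Field n → ℕ
pointWeight {n} p = ∑[ l < 13 ] uncurry (lineWeight (slopes l)) (line n (slopes l) p)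

totalWeight : ℕ
totalWeight = ∑[ l < 13 ] ∑[ a < 5 ] ∑[ b < 5 ] weight (slopes l) a b

5∤totalWeight : ¬ 5 ∣ totalWeight
5∤totalWeight = from-no (5 ∣? totalWeight)

5∣pointWeight-ℤ₅³ : ∀ a b c → 5 ∣ pointWeight {5} (a ∷ b ∷ c ∷ [])
5∣pointWeight-ℤ₅³ =
  from-yes (all? λ a → all? λ b → all? λ c → 5 ∣? pointWeight {5} (a ∷ b ∷ c ∷ []))

5∣pointWeight : ∀ {n} .{{_ : NonZero n}} → 5 ∣ n → (p : Field n) → 5 ∣ pointWeight p
5∣pointWeight {n} 5∣n p =
  subst (5 ∣_) (sym pointWeight-reduce) (5∣pointWeight-ℤ₅³ (p̄ 0F) (p̄ 1F) (p̄ 2F))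
  where
  p̄ : Field 5
  p̄ = reduce 5 ∘ p

  p̄-expand : ∀ j → p̄ j ≡ (p̄ 0F ∷ p̄ 1F ∷ p̄ 2F ∷ []) j
  p̄-expand 0F = refl
  p̄-expand 1F = refl
  p̄-expand 2F = refl

  pointWeight-reduce : pointWeight p ≡ pointWeight {5} (p̄ 0F ∷ p̄ 1F ∷ p̄ 2F ∷ [])
  pointWeight-reduce = sum-cong-≗ {13} λ l → let σ = slopes l in begin
    uncurry (lineWeight σ) (line n σ p)
      ≡⟨ sym (cong₂ (weight σ) (reduce-id _) (reduce-id _)) ⟩
    uncurry (lineWeight σ) (map (reduce 5) (reduce 5) (line n σ p))
      ≡⟨ cong (uncurry (lineWeight σ)) (sym (line-reduce 5∣n σ p)) ⟩
    uncurry (lineWeight σ) (line 5 σ p̄)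
      ≡⟨ cong (uncurry (lineWeight σ)) (line-cong σ p̄-expand) ⟩
    uncurry (lineWeight σ) (line 5 σ (p̄ 0F ∷ p̄ 1F ∷ p̄ 2F ∷ []))
      ∎

∑-pointWeight : ∀ {n N} .{{_ : NonZero n}} → n * n ≤ N → ((q , _) : NonConflictingPlacement n N) →
                ∑[ t < N ] pointWeight (q t) ≡
                ∑[ l < 13 ] ∑[ a < n ] ∑[ b < n ] lineWeight (slopes l) a b
∑-pointWeight {n} {N} nn≤N P@(q , _) = begin
  ∑[ t < N ] ∑[ l < 13 ] uncurry (lineWeight (slopes l)) (line n (slopes l) (q t))
    ≡⟨ ∑-comm (λ t l → uncurry (lineWeight (slopes l)) (line n (slopes l) (q t))) ⟩
  ∑[ l < 13 ] ∑[ t < N ] uncurry (lineWeight (slopes l)) (line n (slopes l) (q t))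
    ≡⟨ sum-cong-≗ {13} (λ l →
         ∑-injective-pairs _ nn≤N (placement-line-injective P (slopes l)) (lineWeight (slopes l))) ⟩
  ∑[ l < 13 ] ∑[ a < n ] ∑[ b < n ] lineWeight (slopes l) a b
    ∎

∑-lineWeight : ∀ m σ → ∑[ a < m * 5 ] ∑[ b < m * 5 ] lineWeight σ a b ≡
                       m * (m * ∑[ a < 5 ] ∑[ b < 5 ] weight σ a b)
∑-lineWeight m σ = begin
  ∑[ a < m * 5 ] ∑[ b < m * 5 ] weight σ (reduce 5 a) (reduce 5 b)
    ≡⟨ sum-cong-≗ {m * 5} (λ a → ∑-periodic m 5 (weight σ (reduce 5 a))) ⟩
  ∑[ a < m * 5 ] (m * ∑[ b < 5 ] weight σ (reduce 5 a) b)
    ≡⟨ sym (*-distribˡ-sum {m * 5} m (λ a → ∑[ b < 5 ] weight σ (reduce 5 a) b)) ⟩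
  m * ∑[ a < m * 5 ] ∑[ b < 5 ] weight σ (reduce 5 a) b
    ≡⟨ cong (m *_) (∑-periodic m 5 (λ a → ∑[ b < 5 ] weight σ a b)) ⟩
  m * (m * ∑[ a < 5 ] ∑[ b < 5 ] weight σ a b)
    ∎

∑-allLines : ∀ m → ∑[ l < 13 ] ∑[ a < m * 5 ] ∑[ b < m * 5 ] lineWeight (slopes l) a b ≡
                   m * (m * totalWeight)
∑-allLines m = begin
  ∑[ l < 13 ] ∑[ a < m * 5 ] ∑[ b < m * 5 ] lineWeight (slopes l) a b
    ≡⟨ sum-cong-≗ {13} (∑-lineWeight m ∘ slopes) ⟩
  ∑[ l < 13 ] (m * (m * W l))
    ≡⟨ sym (*-distribˡ-sum m (λ l → m * W l)) ⟩
  m * ∑[ l < 13 ] (m * W l)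
    ≡⟨ cong (m *_) (sym (*-distribˡ-sum m W)) ⟩
  m * (m * totalWeight)
    ∎
  where
  W : Fin 13 → ℕ
  W l = ∑[ a < 5 ] ∑[ b < 5 ] weight (slopes l) a b

prime∤* : ∀ {p a b} → Prime p → ¬ p ∣ a → ¬ p ∣ b → ¬ p ∣ a * b
prime∤* {a = a} {b} p-prime p∤a p∤b p∣ab with euclidsLemma a b p-prime p∣ab
... | inj₁ p∣a = p∤a p∣a
... | inj₂ p∣b = p∤b p∣b

no-placement : ∀ m → ¬ 5 ∣ m → ¬ NonConflictingPlacement (m * 5) ((m * 5) ^ 2)
no-placement zero        5∤m _           = 5∤m (5 ∣0)
no-placement m@(suc _)   5∤m P@(q , _)   = 5∤m²W (subst (5 ∣_) ∑weights 5∣∑weights)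
  where
  n : ℕ
  n = m * 5

  ∑weights : ∑[ t < n ^ 2 ] pointWeight (q t) ≡ m * (m * totalWeight)
  ∑weights = trans (∑-pointWeight n*n≤n² P) (∑-allLines m)
    where
    n*n≤n² : n * n ≤ n ^ 2
    n*n≤n² = ≤-reflexive (cong (n *_) (sym (*-identityʳ n)))

  5∣∑weights : 5 ∣ ∑[ t < n ^ 2 ] pointWeight (q t)
  5∣∑weights = ∑-divisible 5 _ (5∣pointWeight (n∣m*n m) ∘ q)

  5∤m²W : ¬ 5 ∣ m * (m * totalWeight)
  5∤m²W = prime∤* prime5 5∤m (prime∤* prime5 5∤m 5∤totalWeight)
    where
    prime5 : Prime 5
    prime5 = from-yes (prime? 5)

theorem4 : (n : ℕ) → n > 0 → Coprime n 6 → 5 ∣ n → ¬ (25 ∣ n) →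
    ¬ NonConflictingPlacement n (n ^ 2)
theorem4 _ _ _ (divides m refl) 25∤n = no-placement m (λ 5∣m → 25∤n (*-monoˡ-∣ 5 5∣m))
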